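{- Let $k\ge 1$ be an integer and let $n$ be an odd positive integer with $\sigma(n)=2^k n$. Write $n={\Pi}\, q^{2\beta}\prod_{i=1}^{s}p_i^{2\beta_i}$, where ${\Pi}$ is the Euler part of $n$, $\beta,\beta_1,\dots,\beta_s$ are positive integers ($s\ge 0$), and $q,p_1,\dots,p_s$ are distinct odd primes (none dividing ${\Pi}$). If $q$ is a Fermat prime, i.e. $q=2^{2^t}+1$ for some integer $t\ge 0$, and $\prod_{i=1}^{s}(2\beta_i+1)\not\equiv 0\pmod q$, then $q^{2\beta}\mid\sigma({\Pi})$.
   Context: $\sigma(m)$ denotes the sum of the positive divisors of $m$. For an odd positive integer $n$, its Euler part ${\Pi}$ is the product of all prime powers $p^e$ with $p^e\parallel n$ (i.e. $p^e\mid n$, $p^{e+1}\nmid n$) and $e$ odd; thus $n={\Pi}M^2$ with $\gcd({\Pi},M)=1$ and every prime dividing $M$ has even exponent in $n$. -}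

module Defs where

open import Data.Nat using (ℕ; zero; suc; _+_; _*_; _^_; _%_)
open import Data.Nat.Divisibility using (_∣_; _∣?_)
open import Data.Nat.Primality using (Prime)
open import Data.Fin using (Fin; zero; suc)
open import Data.List using (List; filter; map; upTo)
open import Data.Nat.ListAction using (sum)
open import Data.Product using (_×_)
open import Relation.Nullary using (¬_)
open import Relation.Binary.PropositionalEquality using (_≡_)

Odd : ℕ → Set
Odd m = m % 2 ≡ 1

Even : ℕ → Set
Even m = m % 2 ≡ 0

σ : ℕ → ℕ
σ m = sum (filter (_∣? m) (map suc (upTo m)))

∏ : (s : ℕ) → (Fin s → ℕ) → ℕ
∏ zero    f = 1
∏ (suc s) f = f zero * ∏ s (λ i → f (suc i))

_^_∥_ : ℕ → ℕ → ℕ → Set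
p ^ e ∥ m = (p ^ e ∣ m) × ¬ (p ^ suc e ∣ m)

-- Π is the Euler part of n: Π divides n, and for every prime p and
-- exponent e with p^e ∥ n, p^e ∥ Π when e is odd, and p ∤ Π when e is even.
-- (For n ≥ 1 this determines Π uniquely: it is the product of the p^e ∥ n with e odd.)
IsEulerPart : ℕ → ℕ → Set
IsEulerPart n Π =
  (Π ∣ n) ×
  ((p e : ℕ) → Prime p → p ^ e ∥ n →
     (Odd e → p ^ e ∥ Π) × (Even e → ¬ (p ∣ Π)))

-- Write n = Π · Q · P with Q = q^(2β) and P = ∏ pᵢ^(2βᵢ); the three factors are pairwise coprime,
-- so by multiplicativity σ n = σ Π · σ Q · σ P, and Q ∣ n ∣ σ n.  It therefore suffices that q divides
-- neither σ Q nor σ P.  First, σ (q^e) ≡ 1 (mod q).  Second, if q ∣ σ (p^(2b)) for a prime p, then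
-- p^(2b+1) ≡ 1 (mod q) because (p − 1) σ (p^(2b)) = p^(2b+1) − 1; with Fermat's p^q ≡ p and
-- gcd (2b + 1, q − 1) = gcd (2b + 1, 2^N) = 1 this forces p ≡ 1, so σ (p^(2b)) ≡ 2b + 1 (mod q) and
-- q ∣ 2b + 1, against q ∤ ∏ (2βᵢ + 1).

module Submission where

open import Defs
open import Data.Nat
open import Data.Nat.Properties
open import Data.Nat.Divisibility
open import Data.Nat.DivMod using (%-distribˡ-+; %-distribˡ-*; %-remove-+ʳ; m*n%n≡0)
open import Data.Nat.GCD using (gcd; gcd[m,n]∣m; gcd[m,n]∣n; gcd[m,n]≤n; gcd-greatest; c*gcd[m,n]≡gcd[cm,cn]; module Bézout)
open import Data.Nat.Coprimality as Coprimality using (Coprime; coprime-divisor; coprime-Bézout)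
open import Data.Nat.Primality using (Prime; prime[2]; prime⇒nonZero; prime⇒nonTrivial; prime⇒irreducible; euclidsLemma)
open import Data.Nat.Combinatorics using (_C_; nCn≡1; nC1≡n; k>n⇒nCk≡0; nCk+nC[k+1]≡[n+1]C[k+1])
open import Data.Nat.ListAction using (sum)
open import Data.List using ([]; _∷_; filter; map; applyUpTo; upTo)
open import Data.List.Properties using (map-upTo; map-applyUpTo)
open import Data.Fin using (Fin; zero; suc)
open import Data.Fin.Properties as Fin using ()
open import Data.Empty using (⊥-elim)
open import Data.Product using (∃; _,_)
open import Data.Sum using (inj₁; inj₂; _⊎_; [_,_]′)
open import Function using (_∘_; id)
open import Function.Definitions using (Injective)
open import Relation.Binary.Bundles using (Setoid)
import Relation.Binary.Reasoning.Setoid as SetoidReasoning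
open import Relation.Nullary using (¬_; Dec; yes; no)
open import Relation.Binary.PropositionalEquality
open import Data.Nat.Tactic.RingSolver using (solve-∀)
open import Algebra.Properties.CommutativeSemigroup +-commutativeSemigroup using () renaming (interchange to +-interchange)
open import Algebra.Properties.CommutativeSemigroup *-commutativeSemigroup using (x∙yz≈y∙xz)

∑< : ℕ → (ℕ → ℕ) → ℕ
∑< zero    f = 0
∑< (suc n) f = ∑< n f + f n

∑<-cong : ∀ n {f g} → (∀ i → i < n → f i ≡ g i) → ∑< n f ≡ ∑< n g
∑<-cong zero    eq = refl
∑<-cong (suc n) eq = cong₂ _+_ (∑<-cong n (λ i i<n → eq i (m<n⇒m<1+n i<n))) (eq n ≤-refl)

∑<-zero : ∀ n {f} → (∀ i → i < n → f i ≡ 0) → ∑< n f ≡ 0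
∑<-zero n {f} eq = trans (∑<-cong n eq) (go n)
  where
  go : ∀ n → ∑< n (λ _ → 0) ≡ 0
  go zero    = refl
  go (suc n) = trans (+-identityʳ _) (go n)

∑<-head : ∀ n f → ∑< (suc n) f ≡ f 0 + ∑< n (f ∘ suc)
∑<-head zero    f = +-comm 0 (f 0)
∑<-head (suc n) f = trans (cong (_+ f (suc n)) (∑<-head n f)) (+-assoc (f 0) _ _)

∑<-+ : ∀ m k f → ∑< (m + k) f ≡ ∑< m f + ∑< k (λ i → f (m + i))
∑<-+ m zero    f = trans (cong (λ l → ∑< l f) (+-identityʳ m)) (sym (+-identityʳ _))
∑<-+ m (suc k) f = begin
  ∑< (m + suc k) f                                   ≡⟨ cong (λ l → ∑< l f) (+-suc m k) ⟩
  ∑< (m + k) f + f (m + k)                           ≡⟨ cong (_+ f (m + k)) (∑<-+ m k f) ⟩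
  ∑< m f + ∑< k (λ i → f (m + i)) + f (m + k)        ≡⟨ +-assoc (∑< m f) _ _ ⟩
  ∑< m f + ∑< (suc k) (λ i → f (m + i))              ∎
  where open ≡-Reasoning

∑<-extend : ∀ {m n f} → m ≤ n → (∀ i → m ≤ i → f i ≡ 0) → ∑< n f ≡ ∑< m f
∑<-extend {m} {f = f} m≤n tail with m≤n⇒∃[o]m+o≡n m≤n
... | k , refl = begin
  ∑< (m + k) f                         ≡⟨ ∑<-+ m k f ⟩
  ∑< m f + ∑< k (λ i → f (m + i))      ≡⟨ cong (∑< m f +_) (∑<-zero k (λ i _ → tail (m + i) (m≤m+n m i))) ⟩
  ∑< m f + 0                           ≡⟨ +-identityʳ _ ⟩
  ∑< m f                               ∎
  where open ≡-Reasoning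

∑<-*ˡ : ∀ n c f → c * ∑< n f ≡ ∑< n (λ i → c * f i)
∑<-*ˡ zero    c f = *-zeroʳ c
∑<-*ˡ (suc n) c f = trans (*-distribˡ-+ c (∑< n f) (f n)) (cong (_+ c * f n) (∑<-*ˡ n c f))

∑<-*ʳ : ∀ n c f → ∑< n f * c ≡ ∑< n (λ i → f i * c)
∑<-*ʳ n c f = trans (*-comm (∑< n f) c) (trans (∑<-*ˡ n c f) (∑<-cong n (λ i _ → *-comm c (f i))))

∑<-distrib-+ : ∀ n f g → ∑< n (λ i → f i + g i) ≡ ∑< n f + ∑< n g
∑<-distrib-+ zero    f g = refl
∑<-distrib-+ (suc n) f g = trans (cong (_+ (f n + g n)) (∑<-distrib-+ n f g)) (+-interchange (∑< n f) (∑< n g) (f n) (g n))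

∑<-comm : ∀ m n (f : ℕ → ℕ → ℕ) → ∑< m (λ i → ∑< n (f i)) ≡ ∑< n (λ j → ∑< m (λ i → f i j))
∑<-comm zero    n f = sym (∑<-zero n (λ _ _ → refl))
∑<-comm (suc m) n f = trans (cong (_+ ∑< n (f m)) (∑<-comm m n f)) (sym (∑<-distrib-+ n _ (f m)))

∑<-single : ∀ {n f} d → d < n → (∀ i → i < n → i ≢ d → f i ≡ 0) → ∑< n f ≡ f d
∑<-single {suc n} {f} d d<1+n others with d ≟ n
... | yes refl = cong (_+ f d) (∑<-zero n (λ i i<n → others i (m<n⇒m<1+n i<n) (<⇒≢ i<n)))
... | no d≢n = begin
  ∑< n f + f n   ≡⟨ cong₂ _+_ (∑<-single d (≤∧≢⇒< (≤-pred d<1+n) d≢n) (λ i i<n → others i (m<n⇒m<1+n i<n)))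
                              (others n ≤-refl (d≢n ∘ sym)) ⟩
  f d + 0        ≡⟨ +-identityʳ (f d) ⟩
  f d            ∎
  where open ≡-Reasoning

∑<-∣ : ∀ n {d f} → (∀ i → i < n → d ∣ f i) → d ∣ ∑< n f
∑<-∣ zero    _   = _ ∣0
∑<-∣ (suc n) d∣f = ∣m∣n⇒∣m+n (∑<-∣ n (λ i i<n → d∣f i (m<n⇒m<1+n i<n))) (d∣f n ≤-refl)

𝟙 : ∀ {P : Set} → Dec P → ℕ
𝟙 (yes _) = 1
𝟙 (no _)  = 0

𝟙-yes : ∀ {P : Set} (P? : Dec P) → P → 𝟙 P? ≡ 1
𝟙-yes (yes _) _ = refl
𝟙-yes (no ¬p) p = ⊥-elim (¬p p)

𝟙-no : ∀ {P : Set} (P? : Dec P) → ¬ P → 𝟙 P? ≡ 0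
𝟙-no (yes p) ¬p = ⊥-elim (¬p p)
𝟙-no (no _)  _  = refl

∑<-dilate : ∀ d B (g : ℕ → ℕ) .{{_ : NonZero d}} → ∑< (d * B) (λ j → 𝟙 (d ∣? j) * g j) ≡ ∑< B (λ e → g (d * e))
∑<-dilate d zero g = cong (λ l → ∑< l (λ j → 𝟙 (d ∣? j) * g j)) (*-zeroʳ d)
∑<-dilate d@(suc d-1) (suc B) g = begin
  ∑< (d * suc B) F                                   ≡⟨ cong (λ l → ∑< l F) (trans (*-suc d B) (+-comm d (d * B))) ⟩
  ∑< (d * B + d) F                                   ≡⟨ ∑<-+ (d * B) d F ⟩
  ∑< (d * B) F + ∑< d (λ i → F (d * B + i))          ≡⟨ cong₂ _+_ (∑<-dilate d B g) block ⟩
  ∑< B (λ e → g (d * e)) + g (d * B)                 ∎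
  where
  open ≡-Reasoning
  F : ℕ → ℕ
  F j = 𝟙 (d ∣? j) * g j
  block : ∑< d (λ i → F (d * B + i)) ≡ g (d * B)
  block = begin
    ∑< d (λ i → F (d * B + i))                       ≡⟨ ∑<-head d-1 (λ i → F (d * B + i)) ⟩
    F (d * B + 0) + ∑< d-1 (λ i → F (d * B + suc i)) ≡⟨ cong₂ _+_ first (∑<-zero d-1 rest) ⟩
    g (d * B) + 0                                    ≡⟨ +-identityʳ _ ⟩
    g (d * B)                                        ∎
    where
    first : F (d * B + 0) ≡ g (d * B)
    first rewrite +-identityʳ (d * B) = trans (cong (_* g (d * B)) (𝟙-yes (d ∣? d * B) (m∣m*n B))) (*-identityˡ _)
    rest : ∀ i → i < d-1 → F (d * B + suc i) ≡ 0
    rest i i<d-1 = cong (_* g (d * B + suc i)) (𝟙-no (d ∣? d * B + suc i)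
      (λ d∣ → <⇒≱ (s≤s i<d-1) (∣⇒≤ (∣m+n∣m⇒∣n d∣ (m∣m*n B)))))

-- σ as a divisor sum, and its multiplicativity

divisorTerm : ℕ → ℕ → ℕ
divisorTerm m j = 𝟙 (j ∣? m) * j

divisorTerm-∣ : ∀ {m j} → j ∣ m → divisorTerm m j ≡ j
divisorTerm-∣ {m} {j} j∣m = trans (cong (_* j) (𝟙-yes (j ∣? m) j∣m)) (*-identityˡ j)

divisorTerm-∤ : ∀ {m j} → ¬ j ∣ m → divisorTerm m j ≡ 0
divisorTerm-∤ {m} {j} j∤m = cong (_* j) (𝟙-no (j ∣? m) j∤m)

divisorTerm-> : ∀ {m j} .{{_ : NonZero m}} → m < j → divisorTerm m j ≡ 0
divisorTerm-> m<j = divisorTerm-∤ (λ j∣m → <⇒≱ m<j (∣⇒≤ j∣m))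

divisorTerm-cong : ∀ {m n j} → (j ∣ m → j ∣ n) → (j ∣ n → j ∣ m) → divisorTerm m j ≡ divisorTerm n j
divisorTerm-cong {m} {n} {j} m⇒n n⇒m with j ∣? m | j ∣? n
... | yes _    | yes _    = refl
... | no _     | no _     = refl
... | yes j∣m  | no j∤n   = ⊥-elim (j∤n (m⇒n j∣m))
... | no j∤m   | yes j∣n  = ⊥-elim (j∤m (n⇒m j∣n))

*-divisorTerm : ∀ c m j .{{_ : NonZero c}} → c * divisorTerm m j ≡ divisorTerm (c * m) (c * j)
*-divisorTerm c m j with j ∣? m | c * j ∣? c * m
... | yes _    | yes _     = trans (cong (c *_) (*-identityˡ j)) (sym (*-identityˡ (c * j)))
... | no _     | no _      = *-zeroʳ c
... | yes j∣m  | no cj∤cm  = ⊥-elim (cj∤cm (*-monoʳ-∣ c j∣m))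
... | no j∤m   | yes cj∣cm = ⊥-elim (j∤m (*-cancelˡ-∣ c cj∣cm))

sum-filter : ∀ {P : ℕ → Set} (P? : ∀ x → Dec (P x)) xs → sum (filter P? xs) ≡ sum (map (λ x → 𝟙 (P? x) * x) xs)
sum-filter P? []       = refl
sum-filter P? (x ∷ xs) with P? x
... | yes _ = cong₂ _+_ (sym (+-identityʳ x)) (sum-filter P? xs)
... | no _  = sum-filter P? xs

sum-applyUpTo : ∀ n f → sum (applyUpTo f n) ≡ ∑< n f
sum-applyUpTo zero    f = refl
sum-applyUpTo (suc n) f = trans (cong (f 0 +_) (sum-applyUpTo n (f ∘ suc))) (sym (∑<-head n f))

σ≡∑<divisorTerm : ∀ m → σ m ≡ ∑< (suc m) (divisorTerm m)
σ≡∑<divisorTerm m = begin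
  sum (filter (_∣? m) (map suc (upTo m)))            ≡⟨ sum-filter (_∣? m) (map suc (upTo m)) ⟩
  sum (map (divisorTerm m) (map suc (upTo m)))       ≡⟨ cong (sum ∘ map (divisorTerm m)) (map-upTo suc m) ⟩
  sum (map (divisorTerm m) (applyUpTo suc m))        ≡⟨ cong sum (map-applyUpTo suc (divisorTerm m) m) ⟩
  sum (applyUpTo (divisorTerm m ∘ suc) m)            ≡⟨ sum-applyUpTo m (divisorTerm m ∘ suc) ⟩
  ∑< m (divisorTerm m ∘ suc)                         ≡⟨ cong (_+ ∑< m (divisorTerm m ∘ suc)) (*-zeroʳ (𝟙 (0 ∣? m))) ⟨
  divisorTerm m 0 + ∑< m (divisorTerm m ∘ suc)       ≡⟨ ∑<-head m (divisorTerm m) ⟨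
  ∑< (suc m) (divisorTerm m)                         ∎
  where open ≡-Reasoning

σ≡∑<divisorTerm-beyond : ∀ m N .{{_ : NonZero m}} → m < N → σ m ≡ ∑< N (divisorTerm m)
σ≡∑<divisorTerm-beyond m N m<N = trans (σ≡∑<divisorTerm m) (sym (∑<-extend m<N (λ _ → divisorTerm->)))

∣⇒nonZero : ∀ {d n} .{{_ : NonZero n}} → d ∣ n → NonZero d
∣⇒nonZero {n = n} d∣n = ≢-nonZero λ { refl → ≢-nonZero⁻¹ n (0∣⇒≡0 d∣n) }

-- σ A * σ B is the sum of d e over d ∣ A and e ∣ B.  Indexing by j = d e, the pair (d, j) contributes
-- F d j, and for each j ∣ A * B exactly one d contributes, namely gcd j A.
module σ-Multiplicative (A B : ℕ) {{_ : NonZero A}} {{_ : NonZero B}} (A⊥B : Coprime A B) where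

  N : ℕ
  N = A * suc B

  F : ℕ → ℕ → ℕ
  F d j = 𝟙 (d ∣? A) * (𝟙 (d ∣? j) * divisorTerm (d * B) j)

  divisorTerm*σ : ∀ d → divisorTerm A d * σ B ≡ ∑< N (F d)
  divisorTerm*σ d with d ∣? A
  ... | no _    = sym (∑<-zero N (λ _ _ → refl))
  ... | yes d∣A = begin
    (1 * d) * σ B                                              ≡⟨ cong (_* σ B) (*-identityˡ d) ⟩
    d * σ B                                                    ≡⟨ cong (d *_) (σ≡∑<divisorTerm B) ⟩
    d * ∑< (suc B) (divisorTerm B)                             ≡⟨ ∑<-*ˡ (suc B) d (divisorTerm B) ⟩
    ∑< (suc B) (λ e → d * divisorTerm B e)                     ≡⟨ ∑<-cong (suc B) (λ e _ → *-divisorTerm d B e) ⟩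
    ∑< (suc B) (λ e → divisorTerm (d * B) (d * e))             ≡⟨ ∑<-dilate d (suc B) (divisorTerm (d * B)) ⟨
    ∑< (d * suc B) (λ j → 𝟙 (d ∣? j) * divisorTerm (d * B) j)  ≡⟨ ∑<-extend (*-monoˡ-≤ (suc B) (∣⇒≤ d∣A)) beyond ⟨
    ∑< N (λ j → 𝟙 (d ∣? j) * divisorTerm (d * B) j)            ≡⟨ ∑<-cong N (λ j _ → *-identityˡ _) ⟨
    ∑< N (λ j → 1 * (𝟙 (d ∣? j) * divisorTerm (d * B) j))      ∎
    where
    open ≡-Reasoning
    instance
      _ = ∣⇒nonZero d∣A
      _ = m*n≢0 d B
    beyond : ∀ j → d * suc B ≤ j → 𝟙 (d ∣? j) * divisorTerm (d * B) j ≡ 0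
    beyond j dB<j = trans (cong (𝟙 (d ∣? j) *_) (divisorTerm-> (<-≤-trans dB<d[1+B] dB<j))) (*-zeroʳ (𝟙 (d ∣? j)))
      where
      dB<d[1+B] : d * B < d * suc B
      dB<d[1+B] = *-monoʳ-< d (n<1+n B)

  ≡gcd : ∀ {d j} → d ∣ A → d ∣ j → j ∣ d * B → d ≡ gcd j A
  ≡gcd {d} {j} d∣A d∣j j∣dB = ∣-antisym (gcd-greatest d∣j d∣A) (coprime-divisor g⊥B g∣B*d)
    where
    g⊥B : Coprime (gcd j A) B
    g⊥B (c∣g , c∣B) = A⊥B (∣-trans c∣g (gcd[m,n]∣n j A) , c∣B)
    g∣B*d : gcd j A ∣ B * d
    g∣B*d = ∣-trans (gcd[m,n]∣m j A) (subst (j ∣_) (*-comm d B) j∣dB)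

  ∣gcd*B⇒∣A*B : ∀ {j} → j ∣ gcd j A * B → j ∣ A * B
  ∣gcd*B⇒∣A*B {j} j∣gB = ∣-trans j∣gB (*-monoˡ-∣ B (gcd[m,n]∣n j A))

  ∣A*B⇒∣gcd*B : ∀ {j} → j ∣ A * B → j ∣ gcd j A * B
  ∣A*B⇒∣gcd*B {j} j∣AB = subst (j ∣_) (trans (sym (c*gcd[m,n]≡gcd[cm,cn] B j A)) (*-comm B (gcd j A)))
                                  (gcd-greatest (n∣m*n B) (subst (j ∣_) (*-comm A B) j∣AB))

  ∑<F≡divisorTerm : ∀ j → ∑< (suc A) (λ d → F d j) ≡ divisorTerm (A * B) j
  ∑<F≡divisorTerm j = begin
    ∑< (suc A) (λ d → F d j)                ≡⟨ ∑<-single g (s≤s (gcd[m,n]≤n j A)) (λ d _ → vanish d) ⟩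
    F g j                                   ≡⟨ cong₂ (λ x y → x * (y * divisorTerm (g * B) j))
                                                      (𝟙-yes (g ∣? A) (gcd[m,n]∣n j A)) (𝟙-yes (g ∣? j) (gcd[m,n]∣m j A)) ⟩
    1 * (1 * divisorTerm (g * B) j)         ≡⟨ trans (*-identityˡ _) (*-identityˡ _) ⟩
    divisorTerm (g * B) j                   ≡⟨ divisorTerm-cong (∣gcd*B⇒∣A*B {j}) ∣A*B⇒∣gcd*B ⟩
    divisorTerm (A * B) j                   ∎
    where
    open ≡-Reasoning
    g = gcd j A
    vanish : ∀ d → d ≢ g → F d j ≡ 0
    vanish d d≢g with d ∣? A | d ∣? j | j ∣? d * B
    ... | yes d∣A | yes d∣j | yes j∣dB = ⊥-elim (d≢g (≡gcd d∣A d∣j j∣dB))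
    ... | yes _   | yes _   | no _     = refl
    ... | yes _   | no _    | _        = refl
    ... | no _    | _       | _        = refl

  σ-* : σ (A * B) ≡ σ A * σ B
  σ-* = sym (begin
    σ A * σ B                                  ≡⟨ cong (_* σ B) (σ≡∑<divisorTerm A) ⟩
    ∑< (suc A) (divisorTerm A) * σ B           ≡⟨ ∑<-*ʳ (suc A) (σ B) (divisorTerm A) ⟩
    ∑< (suc A) (λ d → divisorTerm A d * σ B)   ≡⟨ ∑<-cong (suc A) (λ d _ → divisorTerm*σ d) ⟩
    ∑< (suc A) (λ d → ∑< N (F d))              ≡⟨ ∑<-comm (suc A) N F ⟩
    ∑< N (λ j → ∑< (suc A) (λ d → F d j))      ≡⟨ ∑<-cong N (λ j _ → ∑<F≡divisorTerm j) ⟩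
    ∑< N (divisorTerm (A * B))                 ≡⟨ σ≡∑<divisorTerm-beyond (A * B) N AB<N ⟨
    σ (A * B)                                  ∎)
    where
    open ≡-Reasoning
    instance _ = m*n≢0 A B
    AB<N : A * B < N
    AB<N = *-monoʳ-< A (n<1+n B)

σ-* : ∀ A B {{_ : NonZero A}} {{_ : NonZero B}} → Coprime A B → σ (A * B) ≡ σ A * σ B
σ-* A B = σ-Multiplicative.σ-* A B

prime∤⇒coprime : ∀ {p n} → Prime p → ¬ p ∣ n → Coprime p n
prime∤⇒coprime pp p∤n (d∣p , d∣n) with prime⇒irreducible pp d∣p
... | inj₁ d≡1 = d≡1
... | inj₂ refl = ⊥-elim (p∤n d∣n)

coprime-*ʳ : ∀ {a b c} → Coprime a b → Coprime a c → Coprime a (b * c)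
coprime-*ʳ a⊥b a⊥c (d∣a , d∣bc) = a⊥c (d∣a , coprime-divisor d⊥b d∣bc)
  where
  d⊥b : Coprime _ _
  d⊥b (e∣d , e∣b) = a⊥b (∣-trans e∣d d∣a , e∣b)

coprime-^ʳ : ∀ {a b} → Coprime a b → ∀ e → Coprime a (b ^ e)
coprime-^ʳ a⊥b zero    (_ , d∣1) = ∣1⇒≡1 d∣1
coprime-^ʳ a⊥b (suc e) = coprime-*ʳ a⊥b (coprime-^ʳ a⊥b e)

coprime-*ˡ : ∀ {a b c} → Coprime a c → Coprime b c → Coprime (a * b) c
coprime-*ˡ a⊥c b⊥c = Coprimality.sym (coprime-*ʳ (Coprimality.sym a⊥c) (Coprimality.sym b⊥c))

coprime-^ˡ : ∀ {a b} → Coprime a b → ∀ e → Coprime (a ^ e) b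
coprime-^ˡ a⊥b e = Coprimality.sym (coprime-^ʳ (Coprimality.sym a⊥b) e)

coprime-^ : ∀ {a b} → Coprime a b → ∀ x y → Coprime (a ^ x) (b ^ y)
coprime-^ a⊥b x y = coprime-^ˡ (coprime-^ʳ a⊥b y) x

prime∣prime⇒≡ : ∀ {p q} → Prime p → Prime q → p ∣ q → p ≡ q
prime∣prime⇒≡ pp qq p∣q with prime⇒irreducible qq p∣q
... | inj₁ p≡1 = ⊥-elim (nonTrivial⇒≢1 {{prime⇒nonTrivial pp}} p≡1)
... | inj₂ p≡q = p≡q

prime∤* : ∀ {p a b} → Prime p → ¬ p ∣ a → ¬ p ∣ b → ¬ p ∣ a * b
prime∤* {a = a} {b} pp p∤a p∤b = [ p∤a , p∤b ]′ ∘ euclidsLemma a b pp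

∣p^[1+e]⇒∣p^e⊎≡ : ∀ {p} → Prime p → ∀ e {d} → d ∣ p ^ suc e → d ∣ p ^ e ⊎ d ≡ p ^ suc e
∣p^[1+e]⇒∣p^e⊎≡ {p} pp e {d} d∣p^[1+e] with p ∣? d
... | no p∤d = inj₁ (coprime-divisor (Coprimality.sym (prime∤⇒coprime pp p∤d)) d∣p^[1+e])
... | yes (divides c refl) = lift e (*-cancelˡ-∣ p (subst (_∣ p * p ^ e) (*-comm c p) d∣p^[1+e]))
  where
  instance _ = prime⇒nonZero pp
  lift : ∀ e → c ∣ p ^ e → c * p ∣ p ^ e ⊎ c * p ≡ p ^ suc e
  lift zero    c∣1 = inj₂ (trans (cong (_* p) (∣1⇒≡1 c∣1)) (trans (*-identityˡ p) (sym (*-identityʳ p))))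
  lift (suc e) c∣p^[1+e] with ∣p^[1+e]⇒∣p^e⊎≡ pp e c∣p^[1+e]
  ... | inj₁ c∣p^e = inj₁ (subst (c * p ∣_) (*-comm (p ^ e) p) (*-monoˡ-∣ p c∣p^e))
  ... | inj₂ refl  = inj₂ (*-comm (p ^ suc e) p)

σ[p^[1+e]] : ∀ {p} → Prime p → ∀ e → σ (p ^ suc e) ≡ σ (p ^ e) + p ^ suc e
σ[p^[1+e]] {p} pp e = begin
  σ (p ^ suc e)                                ≡⟨ σ≡∑<divisorTerm (p ^ suc e) ⟩
  ∑< (p ^ suc e) (divisorTerm (p ^ suc e)) + divisorTerm (p ^ suc e) (p ^ suc e)
                                               ≡⟨ cong₂ _+_ (∑<-cong (p ^ suc e) (λ j j<p^[1+e] → below j<p^[1+e])) (divisorTerm-∣ ∣-refl) ⟩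
  ∑< (p ^ suc e) (divisorTerm (p ^ e)) + p ^ suc e
                                               ≡⟨ cong (_+ p ^ suc e) (σ≡∑<divisorTerm-beyond (p ^ e) (p ^ suc e) p^e<p^[1+e]) ⟨
  σ (p ^ e) + p ^ suc e                        ∎
  where
  open ≡-Reasoning
  instance
    _ = prime⇒nonZero pp
    _ = m^n≢0 p e
  p^e<p^[1+e] : p ^ e < p ^ suc e
  p^e<p^[1+e] = subst (p ^ e <_) (*-comm (p ^ e) p) (m<m*n (p ^ e) p (nonTrivial⇒n>1 p {{prime⇒nonTrivial pp}}))
  below : ∀ {j} → j < p ^ suc e → divisorTerm (p ^ suc e) j ≡ divisorTerm (p ^ e) j
  below {j} j<p^[1+e] = divisorTerm-cong down (λ j∣p^e → ∣-trans j∣p^e (n∣m*n p))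
    where
    down : j ∣ p ^ suc e → j ∣ p ^ e
    down j∣p^[1+e] with ∣p^[1+e]⇒∣p^e⊎≡ pp e j∣p^[1+e]
    ... | inj₁ j∣p^e = j∣p^e
    ... | inj₂ refl  = ⊥-elim (<-irrefl refl j<p^[1+e])

σ[p^e]-geometric : ∀ {p} → Prime p → ∀ e → p * σ (p ^ e) + 1 ≡ σ (p ^ e) + p ^ suc e
σ[p^e]-geometric {p} pp zero = +-comm (p * 1) 1
σ[p^e]-geometric {p} pp (suc e) = begin
  p * σ (p ^ suc e) + 1                         ≡⟨ cong (λ x → p * x + 1) (σ[p^[1+e]] pp e) ⟩
  p * (σ (p ^ e) + p ^ suc e) + 1               ≡⟨ regroup p (σ (p ^ e)) (p ^ suc e) ⟩
  (p * σ (p ^ e) + 1) + p ^ suc (suc e)         ≡⟨ cong (_+ p ^ suc (suc e)) (σ[p^e]-geometric pp e) ⟩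
  σ (p ^ e) + p ^ suc e + p ^ suc (suc e)       ≡⟨ cong (_+ p ^ suc (suc e)) (σ[p^[1+e]] pp e) ⟨
  σ (p ^ suc e) + p ^ suc (suc e)               ∎
  where
  open ≡-Reasoning
  regroup : ∀ a b c → a * (b + c) + 1 ≡ (a * b + 1) + a * c
  regroup = solve-∀

-- Congruences and Fermat's little theorem

-- A record rather than a % q ≡ b % q, so that a and b can be inferred from a congruence.
infix 4 _≡_mod_
record _≡_mod_ (a b q : ℕ) .{{_ : NonZero q}} : Set where
  constructor congruent
  field %-≡ : a % q ≡ b % q

module _ {q : ℕ} {{_ : NonZero q}} where

  mod-refl : ∀ {a} → a ≡ a mod q
  mod-refl = congruent refl

  mod-sym : ∀ {a b} → a ≡ b mod q → b ≡ a mod q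
  mod-sym (congruent eq) = congruent (sym eq)

  mod-trans : ∀ {a b c} → a ≡ b mod q → b ≡ c mod q → a ≡ c mod q
  mod-trans (congruent eq₁) (congruent eq₂) = congruent (trans eq₁ eq₂)

  ≡⇒mod : ∀ {a b} → a ≡ b → a ≡ b mod q
  ≡⇒mod refl = mod-refl

  +-cong-mod : ∀ {a b c d} → a ≡ b mod q → c ≡ d mod q → a + c ≡ b + d mod q
  +-cong-mod {a} {b} {c} {d} (congruent eq₁) (congruent eq₂) = congruent (begin
    (a + c) % q              ≡⟨ %-distribˡ-+ a c q ⟩
    (a % q + c % q) % q      ≡⟨ cong₂ (λ x y → (x + y) % q) eq₁ eq₂ ⟩
    (b % q + d % q) % q      ≡⟨ %-distribˡ-+ b d q ⟨
    (b + d) % q              ∎)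
    where open ≡-Reasoning

  *-cong-mod : ∀ {a b c d} → a ≡ b mod q → c ≡ d mod q → a * c ≡ b * d mod q
  *-cong-mod {a} {b} {c} {d} (congruent eq₁) (congruent eq₂) = congruent (begin
    (a * c) % q              ≡⟨ %-distribˡ-* a c q ⟩
    (a % q * (c % q)) % q    ≡⟨ cong₂ (λ x y → (x * y) % q) eq₁ eq₂ ⟩
    (b % q * (d % q)) % q    ≡⟨ %-distribˡ-* b d q ⟨
    (b * d) % q              ∎)
    where open ≡-Reasoning

  ^-cong-mod : ∀ {a b} e → a ≡ b mod q → a ^ e ≡ b ^ e mod q
  ^-cong-mod zero    a≡b = mod-refl
  ^-cong-mod (suc e) a≡b = *-cong-mod a≡b (^-cong-mod e a≡b)

  ∣⇒≡0-mod : ∀ {a} → q ∣ a → a ≡ 0 mod q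
  ∣⇒≡0-mod {a} q∣a = congruent (trans (n∣m⇒m%n≡0 a q q∣a) (sym (m*n%n≡0 0 q)))

  ≡0-mod⇒∣ : ∀ {a} → a ≡ 0 mod q → q ∣ a
  ≡0-mod⇒∣ {a} (congruent eq) = m%n≡0⇒n∣m a q (trans eq (m*n%n≡0 0 q))

  +-multiple-mod : ∀ a {m} → q ∣ m → a + m ≡ a mod q
  +-multiple-mod a q∣m = congruent (%-remove-+ʳ a q∣m)

  mod-setoid : Setoid _ _
  mod-setoid = record
    { Carrier       = ℕ
    ; _≈_           = _≡_mod q
    ; isEquivalence = record { refl = mod-refl ; sym = mod-sym ; trans = mod-trans }
    }

  module mod-Reasoning = SetoidReasoning mod-setoid

[1+k]*[1+n]C[1+k]≡[1+n]*nCk : ∀ n k → suc k * (suc n C suc k) ≡ suc n * (n C k)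
[1+k]*[1+n]C[1+k]≡[1+n]*nCk n zero = begin
  1 * (suc n C 1)         ≡⟨ *-identityˡ _ ⟩
  suc n C 1               ≡⟨ nC1≡n (suc n) ⟩
  suc n                   ≡⟨ *-identityʳ (suc n) ⟨
  suc n * 1               ∎
  where open ≡-Reasoning
[1+k]*[1+n]C[1+k]≡[1+n]*nCk zero (suc k) = begin
  suc (suc k) * (1 C suc (suc k))   ≡⟨ cong (suc (suc k) *_) (k>n⇒nCk≡0 (s<s (z<s {k}))) ⟩
  suc (suc k) * 0                   ≡⟨ *-zeroʳ (suc (suc k)) ⟩
  0                                 ≡⟨ cong (1 *_) (k>n⇒nCk≡0 (z<s {k})) ⟨
  1 * (0 C suc k)                   ∎
  where open ≡-Reasoning
[1+k]*[1+n]C[1+k]≡[1+n]*nCk (suc n) (suc k) = begin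
  suc (suc k) * (suc (suc n) C suc (suc k))       ≡⟨ cong (suc (suc k) *_) (nCk+nC[k+1]≡[n+1]C[k+1] (suc n) (suc k)) ⟨
  suc (suc k) * (X + Y)                           ≡⟨ *-distribˡ-+ (suc (suc k)) X Y ⟩
  (X + suc k * X) + suc (suc k) * Y               ≡⟨ cong₂ (λ x y → (X + x) + y) ([1+k]*[1+n]C[1+k]≡[1+n]*nCk n k) ([1+k]*[1+n]C[1+k]≡[1+n]*nCk n (suc k)) ⟩
  (X + suc n * (n C k)) + suc n * (n C suc k)     ≡⟨ +-assoc X _ _ ⟩
  X + (suc n * (n C k) + suc n * (n C suc k))     ≡⟨ cong (X +_) (*-distribˡ-+ (suc n) (n C k) (n C suc k)) ⟨
  X + suc n * (n C k + n C suc k)                 ≡⟨ cong (λ x → X + suc n * x) (nCk+nC[k+1]≡[n+1]C[k+1] n k) ⟩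
  suc (suc n) * X                                 ∎
  where
  open ≡-Reasoning
  X = suc n C suc k
  Y = suc n C suc (suc k)

prime∣pCk : ∀ {p k} → Prime p → 0 < k → k < p → p ∣ p C k
prime∣pCk {suc n} {suc k} pp _ k<p =
  [ (λ p∣1+k → ⊥-elim (<⇒≱ k<p (∣⇒≤ p∣1+k))) , id ]′ (euclidsLemma (suc k) (suc n C suc k) pp p∣[1+k]*pCk)
  where
  p∣[1+k]*pCk : suc n ∣ suc k * (suc n C suc k)
  p∣[1+k]*pCk = divides (n C k) (trans ([1+k]*[1+n]C[1+k]≡[1+n]*nCk n k) (*-comm (suc n) (n C k)))

binomial : ∀ n x → suc x ^ n ≡ ∑< (suc n) (λ k → (n C k) * x ^ k)
binomial zero    x = refl
binomial (suc n) x = sym (begin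
  ∑< (suc (suc n)) (λ k → (suc n C k) * x ^ k)                   ≡⟨ ∑<-head (suc n) (λ k → (suc n C k) * x ^ k) ⟩
  1 + ∑< (suc n) (λ k → (suc n C suc k) * x ^ suc k)             ≡⟨ cong (1 +_) (∑<-cong (suc n) (λ k _ → pascal k)) ⟩
  1 + ∑< (suc n) (λ k → x * ((n C k) * x ^ k) + T k)             ≡⟨ cong (1 +_) (∑<-distrib-+ (suc n) _ T) ⟩
  1 + (∑< (suc n) (λ k → x * ((n C k) * x ^ k)) + ∑< (suc n) T)  ≡⟨ cong (λ s → 1 + (s + ∑< (suc n) T)) (∑<-*ˡ (suc n) x _) ⟨
  1 + (x * S + ∑< (suc n) T)                                     ≡⟨ +-suc (x * S) (∑< (suc n) T) ⟨
  x * S + (1 + ∑< (suc n) T)                                     ≡⟨ cong (x * S +_) shifted ⟩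
  x * S + S                                                      ≡⟨ +-comm (x * S) S ⟩
  S + x * S                                                      ≡⟨ cong (λ s → s + x * s) (binomial n x) ⟨
  suc x ^ suc n                                                  ∎)
  where
  open ≡-Reasoning
  S = ∑< (suc n) (λ k → (n C k) * x ^ k)
  T : ℕ → ℕ
  T k = (n C suc k) * x ^ suc k
  pascal : ∀ k → (suc n C suc k) * x ^ suc k ≡ x * ((n C k) * x ^ k) + T k
  pascal k = begin
    (suc n C suc k) * x ^ suc k       ≡⟨ cong (_* x ^ suc k) (nCk+nC[k+1]≡[n+1]C[k+1] n k) ⟨
    (n C k + n C suc k) * x ^ suc k   ≡⟨ *-distribʳ-+ (x ^ suc k) (n C k) (n C suc k) ⟩
    (n C k) * (x * x ^ k) + T k       ≡⟨ cong (_+ T k) (x∙yz≈y∙xz (n C k) x (x ^ k)) ⟩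
    x * ((n C k) * x ^ k) + T k       ∎
  shifted : 1 + ∑< (suc n) T ≡ S
  shifted = begin
    1 + ∑< (suc n) T                  ≡⟨ ∑<-head (suc n) (λ k → (n C k) * x ^ k) ⟨
    S + (n C suc n) * x ^ suc n       ≡⟨ cong (λ c → S + c * x ^ suc n) (k>n⇒nCk≡0 (n<1+n n)) ⟩
    S + 0                             ≡⟨ +-identityʳ S ⟩
    S                                 ∎

[1+x]^p≡1+x^p : ∀ {n} → Prime (suc n) → ∀ x → suc x ^ suc n ≡ suc (x ^ suc n) mod suc n
[1+x]^p≡1+x^p {n} pp x = begin
  suc x ^ suc n                                     ≡⟨ binomial (suc n) x ⟩
  ∑< (suc (suc n)) (λ k → (suc n C k) * x ^ k)      ≡⟨ ∑<-head (suc n) (λ k → (suc n C k) * x ^ k) ⟩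
  1 + (M + (suc n C suc n) * x ^ suc n)             ≡⟨ cong (λ c → 1 + (M + c * x ^ suc n)) (nCn≡1 (suc n)) ⟩
  1 + (M + 1 * x ^ suc n)                           ≡⟨ cong (λ y → 1 + (M + y)) (*-identityˡ (x ^ suc n)) ⟩
  1 + (M + x ^ suc n)                               ≡⟨ cong suc (+-comm M (x ^ suc n)) ⟩
  suc (x ^ suc n) + M                               ≈⟨ +-multiple-mod (suc (x ^ suc n)) p∣M ⟩
  suc (x ^ suc n)                                   ∎
  where
  open mod-Reasoning
  M = ∑< n (λ k → (suc n C suc k) * x ^ suc k)
  p∣M : suc n ∣ M
  p∣M = ∑<-∣ n (λ k k<n → ∣-trans (prime∣pCk pp z<s (s<s k<n)) (m∣m*n (x ^ suc k)))

fermat : ∀ {n} → Prime (suc n) → ∀ x → x ^ suc n ≡ x mod suc n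
fermat pp zero    = mod-refl
fermat pp (suc x) = mod-trans ([1+x]^p≡1+x^p pp x) (+-cong-mod (mod-refl {a = 1}) (fermat pp x))

module _ {q} {{_ : NonZero q}} {a : ℕ} where

  ^-periodic : ∀ {M} → a ^ suc M ≡ a mod q → ∀ y → a ^ (1 + y * M) ≡ a mod q
  ^-periodic     _         zero    = ≡⇒mod (*-identityʳ a)
  ^-periodic {M} a^[1+M]≡a (suc y) = begin
    a ^ (1 + (M + y * M))       ≡⟨ cong (a ^_) (+-suc M (y * M)) ⟨
    a ^ (M + (1 + y * M))       ≡⟨ ^-distribˡ-+-* a M (1 + y * M) ⟩
    a ^ M * a ^ (1 + y * M)     ≈⟨ *-cong-mod (mod-refl {a = a ^ M}) (^-periodic a^[1+M]≡a y) ⟩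
    a ^ M * a                   ≡⟨ *-comm (a ^ M) a ⟩
    a ^ suc M                   ≈⟨ a^[1+M]≡a ⟩
    a                           ∎
    where open mod-Reasoning

  ^-*≡1 : ∀ {m} → a ^ m ≡ 1 mod q → ∀ x → a ^ (x * m) ≡ 1 mod q
  ^-*≡1 {m} a^m≡1 x = begin
    a ^ (x * m)                 ≡⟨ cong (a ^_) (*-comm x m) ⟩
    a ^ (m * x)                 ≡⟨ ^-*-assoc a m x ⟨
    (a ^ m) ^ x                 ≈⟨ ^-cong-mod x a^m≡1 ⟩
    1 ^ x                       ≡⟨ ^-zeroˡ x ⟩
    1                           ∎
    where open mod-Reasoning

-- The multiplicative order of a divides both 1 + m and M, hence is 1.
coprime-exponents⇒≡1 : ∀ {q} {{_ : NonZero q}} {a m M} → Coprime (suc m) M →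
                       a ^ suc m ≡ 1 mod q → a ^ suc M ≡ a mod q → a ≡ 1 mod q
coprime-exponents⇒≡1 {q} {a} {m} {M} [1+m]⊥M a^[1+m]≡1 a^[1+M]≡a with coprime-Bézout [1+m]⊥M
... | Bézout.+- x y 1+yM≡x[1+m] = begin
  a                     ≈⟨ ^-periodic a^[1+M]≡a y ⟨
  a ^ (1 + y * M)       ≡⟨ cong (a ^_) 1+yM≡x[1+m] ⟩
  a ^ (x * suc m)       ≈⟨ ^-*≡1 a^[1+m]≡1 x ⟩
  1                     ∎
  where open mod-Reasoning
... | Bézout.-+ x y 1+x[1+m]≡yM = begin
  a                     ≈⟨ idempotent m ⟨
  a ^ suc m             ≈⟨ a^[1+m]≡1 ⟩
  1                     ∎
  where
  open mod-Reasoning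
  a*a≡a : a * a ≡ a mod q
  a*a≡a = begin
    a * a                           ≡⟨ cong (a *_) (*-identityʳ a) ⟨
    a * (a * 1)                     ≈⟨ *-cong-mod (mod-refl {a = a}) (*-cong-mod (mod-refl {a = a}) (^-*≡1 a^[1+m]≡1 x)) ⟨
    a ^ (1 + (1 + x * suc m))       ≡⟨ cong (λ e → a ^ (1 + e)) 1+x[1+m]≡yM ⟩
    a ^ (1 + y * M)                 ≈⟨ ^-periodic a^[1+M]≡a y ⟩
    a                               ∎
  idempotent : ∀ k → a ^ suc k ≡ a mod q
  idempotent zero    = ≡⇒mod (*-identityʳ a)
  idempotent (suc k) = mod-trans (*-cong-mod (mod-refl {a = a}) (idempotent k)) a*a≡a

-- σ of prime powers modulo a Fermat prime

odd⊥2^N : ∀ b N → Coprime (suc (2 * b)) (2 ^ N)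
odd⊥2^N b = coprime-^ʳ (Coprimality.sym (prime∤⇒coprime prime[2] 2∤odd))
  where
  2∤odd : ¬ 2 ∣ suc (2 * b)
  2∤odd 2∣1+2b = >⇒∤ (n<1+n 1) (∣m+n∣m⇒∣n 2∣2b+1 (m∣m*n b))
    where
    2∣2b+1 : 2 ∣ 2 * b + 1
    2∣2b+1 = subst (2 ∣_) (+-comm 1 (2 * b)) 2∣1+2b

prime∤σ[p^e] : ∀ {p} → Prime p → ∀ e → ¬ p ∣ σ (p ^ e)
prime∤σ[p^e] {p} pp e p∣σ = nonTrivial⇒≢1 {{prime⇒nonTrivial pp}} (∣1⇒≡1 (≡0-mod⇒∣ 1≡0))
  where
  instance _ = prime⇒nonZero pp
  σ≡1 : ∀ e → σ (p ^ e) ≡ 1 mod p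
  σ≡1 zero    = mod-refl
  σ≡1 (suc e) = mod-trans (≡⇒mod (σ[p^[1+e]] pp e)) (mod-trans (+-multiple-mod _ (m∣m*n (p ^ e))) (σ≡1 e))
  1≡0 : 1 ≡ 0 mod p
  1≡0 = mod-trans (mod-sym (σ≡1 e)) (∣⇒≡0-mod p∣σ)

module _ {q} {{_ : NonZero q}} {p} (pp : Prime p) where

  σ[p^e]≡1+e : p ≡ 1 mod q → ∀ e → σ (p ^ e) ≡ suc e mod q
  σ[p^e]≡1+e p≡1 zero    = mod-refl
  σ[p^e]≡1+e p≡1 (suc e) = begin
    σ (p ^ suc e)              ≡⟨ σ[p^[1+e]] pp e ⟩
    σ (p ^ e) + p ^ suc e      ≈⟨ +-cong-mod (σ[p^e]≡1+e p≡1 e) (^-cong-mod (suc e) p≡1) ⟩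
    suc e + 1 ^ suc e          ≡⟨ cong (suc e +_) (^-zeroˡ (suc e)) ⟩
    suc e + 1                  ≡⟨ +-comm (suc e) 1 ⟩
    suc (suc e)                ∎
    where open mod-Reasoning

  ∣σ[p^e]⇒p^[1+e]≡1 : ∀ {e} → q ∣ σ (p ^ e) → p ^ suc e ≡ 1 mod q
  ∣σ[p^e]⇒p^[1+e]≡1 {e} q∣σ = begin
    p ^ suc e                  ≡⟨⟩
    0 + p ^ suc e              ≈⟨ +-cong-mod (mod-sym σ≡0) (mod-refl {a = p ^ suc e}) ⟩
    σ (p ^ e) + p ^ suc e      ≡⟨ σ[p^e]-geometric pp e ⟨
    p * σ (p ^ e) + 1          ≈⟨ +-cong-mod (*-cong-mod (mod-refl {a = p}) σ≡0) (mod-refl {a = 1}) ⟩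
    p * 0 + 1                  ≡⟨ cong (_+ 1) (*-zeroʳ p) ⟩
    1                          ∎
    where
    open mod-Reasoning
    σ≡0 : σ (p ^ e) ≡ 0 mod q
    σ≡0 = ∣⇒≡0-mod q∣σ

prime∣σ[p^m]⇒∣1+m : ∀ {M m p} → Prime (suc M) → Coprime (suc m) M → Prime p → suc M ∣ σ (p ^ m) → suc M ∣ suc m
prime∣σ[p^m]⇒∣1+m {M} {m} {p} qq [1+m]⊥M pp q∣σ = ≡0-mod⇒∣ (begin
  suc m          ≈⟨ σ[p^e]≡1+e pp p≡1 m ⟨
  σ (p ^ m)      ≈⟨ ∣⇒≡0-mod q∣σ ⟩
  0              ∎)
  where
  open mod-Reasoning
  p≡1 : p ≡ 1 mod suc M
  p≡1 = coprime-exponents⇒≡1 [1+m]⊥M (∣σ[p^e]⇒p^[1+e]≡1 pp {m} q∣σ) (fermat qq p)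

fermatPrime∣σ[p^2b]⇒∣2b+1 : ∀ {N b p} → Prime (suc (2 ^ N)) → Prime p → suc (2 ^ N) ∣ σ (p ^ (2 * b)) → suc (2 ^ N) ∣ 2 * b + 1
fermatPrime∣σ[p^2b]⇒∣2b+1 {N} {b} qq pp q∣σ =
  subst (suc (2 ^ N) ∣_) (+-comm 1 (2 * b)) (prime∣σ[p^m]⇒∣1+m qq (odd⊥2^N b N) pp q∣σ)

∏-nonZero : ∀ s {f : Fin s → ℕ} → (∀ i → NonZero (f i)) → NonZero (∏ s f)
∏-nonZero zero    _  = _
∏-nonZero (suc s) nz = m*n≢0 _ _ {{nz zero}} {{∏-nonZero s (nz ∘ suc)}}

coprime-∏ʳ : ∀ s {a} {f : Fin s → ℕ} → (∀ i → Coprime a (f i)) → Coprime a (∏ s f)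
coprime-∏ʳ zero    _   (_ , d∣1) = ∣1⇒≡1 d∣1
coprime-∏ʳ (suc s) a⊥f = coprime-*ʳ (a⊥f zero) (coprime-∏ʳ s (a⊥f ∘ suc))

∣∏ : ∀ s {f : Fin s → ℕ} i {d} → d ∣ f i → d ∣ ∏ s f
∣∏ (suc s) {f} zero    d∣f = ∣-trans d∣f (m∣m*n (∏ s (f ∘ suc)))
∣∏ (suc s) {f} (suc i) d∣f = ∣-trans (∣∏ s {f ∘ suc} i d∣f) (n∣m*n (f zero))

prime∤∏ : ∀ s {p} {f : Fin s → ℕ} → Prime p → (∀ i → ¬ p ∣ f i) → ¬ p ∣ ∏ s f
prime∤∏ zero    pp _   p∣1 = nonTrivial⇒≢1 {{prime⇒nonTrivial pp}} (∣1⇒≡1 p∣1)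
prime∤∏ (suc s) pp p∤f = prime∤* pp (p∤f zero) (prime∤∏ s pp (p∤f ∘ suc))

σ-∏ : ∀ s {f : Fin s → ℕ} → (∀ i → NonZero (f i)) → (∀ {i j} → i ≢ j → Coprime (f i) (f j)) →
      σ (∏ s f) ≡ ∏ s (σ ∘ f)
σ-∏ zero    _  _        = refl
σ-∏ (suc s) {f} nz pairwise = begin
  σ (f zero * ∏ s (f ∘ suc))          ≡⟨ σ-* (f zero) (∏ s (f ∘ suc)) {{nz zero}} {{∏-nonZero s (nz ∘ suc)}}
                                              (coprime-∏ʳ s (λ i → pairwise (λ ()))) ⟩
  σ (f zero) * σ (∏ s (f ∘ suc))      ≡⟨ cong (σ (f zero) *_) (σ-∏ s (nz ∘ suc) (λ i≢j → pairwise (i≢j ∘ Fin.suc-injective))) ⟩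
  σ (f zero) * ∏ s (σ ∘ f ∘ suc)      ∎
  where open ≡-Reasoning

fermatPrime∤σ[∏p^2β] : ∀ {N s} {p βs : Fin s → ℕ} → Prime (suc (2 ^ N)) → (∀ i → Prime (p i)) → Injective _≡_ _≡_ p →
                       ¬ suc (2 ^ N) ∣ ∏ s (λ i → 2 * βs i + 1) → ¬ suc (2 ^ N) ∣ σ (∏ s (λ i → p i ^ (2 * βs i)))
fermatPrime∤σ[∏p^2β] {N} {s} {p} {βs} qq pp p-injective q∤∏ q∣σ∏ =
  prime∤∏ s qq (λ i q∣σ → q∤∏ (∣∏ s i (fermatPrime∣σ[p^2b]⇒∣2b+1 {N} {βs i} qq (pp i) q∣σ)))
    (subst (suc (2 ^ N) ∣_) (σ-∏ s p^2β≢0 pairwise) q∣σ∏)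
  where
  p^2β≢0 : ∀ i → NonZero (p i ^ (2 * βs i))
  p^2β≢0 i = m^n≢0 (p i) (2 * βs i) {{prime⇒nonZero (pp i)}}
  pairwise : ∀ {i j} → i ≢ j → Coprime (p i ^ (2 * βs i)) (p j ^ (2 * βs j))
  pairwise {i} {j} i≢j = coprime-^ (prime∤⇒coprime (pp i) (i≢j ∘ p-injective ∘ prime∣prime⇒≡ (pp i) (pp j))) (2 * βs i) (2 * βs j)

∣σ[ABR]⇒B∣σA : ∀ {A B R} {{_ : NonZero A}} {{_ : NonZero B}} {{_ : NonZero R}} →
               Coprime A B → Coprime (A * B) R → A * B * R ∣ σ (A * B * R) → Coprime B (σ B * σ R) → B ∣ σ A
∣σ[ABR]⇒B∣σA {A} {B} {R} A⊥B AB⊥R ABR∣σ B⊥σBσR = coprime-divisor B⊥σBσR (begin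
  B                              ∣⟨ ∣-trans (n∣m*n A) (m∣m*n R) ⟩
  A * B * R                      ∣⟨ ABR∣σ ⟩
  σ (A * B * R)                  ≡⟨ σ-* (A * B) R AB⊥R ⟩
  σ (A * B) * σ R                ≡⟨ cong (_* σ R) (σ-* A B A⊥B) ⟩
  σ A * σ B * σ R                ≡⟨ *-assoc (σ A) (σ B) (σ R) ⟩
  σ A * (σ B * σ R)              ≡⟨ *-comm (σ A) (σ B * σ R) ⟩
  σ B * σ R * σ A                ∎)
  where
  open ∣-Reasoning
  instance _ = m*n≢0 A B

corollary3p2 :
    (k n : ℕ) → k ≥ 1 → n ≥ 1 → Odd n → σ n ≡ 2 ^ k * n →
    (Π q β s : ℕ) (p : Fin s → ℕ) (βs : Fin s → ℕ) →
    IsEulerPart n Π →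
    β ≥ 1 → (∀ i → βs i ≥ 1) →
    Prime q → Odd q → (∀ i → Prime (p i)) → (∀ i → Odd (p i)) →
    Injective _≡_ _≡_ p → (∀ i → ¬ (q ≡ p i)) →
    ¬ (q ∣ Π) → (∀ i → ¬ (p i ∣ Π)) →
    n ≡ Π * q ^ (2 * β) * ∏ s (λ i → p i ^ (2 * βs i)) →
    ∃ (λ t → q ≡ 2 ^ (2 ^ t) + 1) →
    ¬ (q ∣ ∏ s (λ i → 2 * βs i + 1)) →
    q ^ (2 * β) ∣ σ Π
corollary3p2 k n _ n≥1 _ σn≡2^kn Π q β s p βs _ _ _ qq _ pp _ p-injective q≢p q∤Π p∤Π n≡ΠQP (t , q≡F) q∤∏
  with trans q≡F (+-comm (2 ^ (2 ^ t)) 1)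
... | refl = ∣σ[ABR]⇒B∣σA Π⊥Q (coprime-*ˡ Π⊥P Q⊥P) (subst (λ m → m ∣ σ m) n≡ΠQP (divides (2 ^ k) σn≡2^kn)) Q⊥σQσP
  where
  Q = q ^ (2 * β)
  P = ∏ s (λ i → p i ^ (2 * βs i))
  instance
    _ = m*n≢0⇒m≢0 Π {{m*n≢0⇒m≢0 (Π * Q) {{subst NonZero n≡ΠQP (>-nonZero n≥1)}}}}
    _ = m^n≢0 q (2 * β) {{prime⇒nonZero qq}}
    _ = ∏-nonZero s (λ i → m^n≢0 (p i) (2 * βs i) {{prime⇒nonZero (pp i)}})
  q⊥p : ∀ i → Coprime q (p i)
  q⊥p i = prime∤⇒coprime qq (q≢p i ∘ prime∣prime⇒≡ qq (pp i))
  Π⊥Q : Coprime Π Q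
  Π⊥Q = coprime-^ʳ (Coprimality.sym (prime∤⇒coprime qq q∤Π)) (2 * β)
  Π⊥P : Coprime Π P
  Π⊥P = coprime-∏ʳ s (λ i → coprime-^ʳ (Coprimality.sym (prime∤⇒coprime (pp i) (p∤Π i))) (2 * βs i))
  Q⊥P : Coprime Q P
  Q⊥P = coprime-∏ʳ s (λ i → coprime-^ (q⊥p i) (2 * β) (2 * βs i))
  q∤σQσP : ¬ q ∣ σ Q * σ P
  q∤σQσP = prime∤* qq (prime∤σ[p^e] qq (2 * β)) (fermatPrime∤σ[∏p^2β] {2 ^ t} {βs = βs} qq pp p-injective q∤∏)
  Q⊥σQσP : Coprime Q (σ Q * σ P)
  Q⊥σQσP = coprime-^ˡ (prime∤⇒coprime qq q∤σQσP) (2 * β)
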